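{- Let $n\ge4$ be even, $x\in Y_1$ and $1\le i\le j\le n-1$. Then $\nu_i(x)\le\nu_j(x)$ in the Bruhat order of $\mathcal F_n$.
   Context: $S_n$ symmetric group, $s_i=(i,i+1)$, $\ell$ length, $\mathcal F_m$ fixed-point-free involutions of $S_m$. The Bruhat order on $\mathcal F_n$ is the weakest partial order with $z\le tzt$ for every transposition $t$ with $\ell(z)\le\ell(tzt)$. View $S_{n-2}\subset S_n$ fixing $n-1,n$; $w_0$ longest element of $S_n$; $\rho_n(z)=w_0zs_{n-1}w_0$ for $z\in\mathcal F_{n-2}$; $Y_1=\rho_n(\mathcal F_{n-2})$; $\sigma_j=s_js_{j-1}\cdots s_1$; $\nu_j(x)=\sigma_jx\sigma_j^{ -1}$ for $x\in Y_1$. -}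

module Defs where

open import Data.Nat as ℕ using (ℕ; zero; suc; _∸_; _<?_)
open import Data.Nat.Properties using (m∸n≤m)
open import Data.Fin as Fin using (Fin; toℕ; fromℕ<; inject≤; opposite)
open import Data.Fin.Properties using (_≟_) renaming (_<?_ to _<F?_)
open import Data.List using (List; length; filter; allFin; concatMap; map)
open import Data.Product using (Σ; _×_; _,_; proj₁; proj₂)
open import Relation.Nullary using (yes; no; ¬_)
open import Relation.Nullary.Decidable using (_×-dec_)
open import Relation.Binary.PropositionalEquality using (_≡_; _≢_)
open import Relation.Binary.Construct.Closure.ReflexiveTransitive using (Star)

-- Permutations of {1,…,n} are modelled as maps Fin n → Fin n, where the
-- element k ∈ Fin n stands for the number k+1.  Products are composition:
-- (x · y)(k) = x (y k).
Perm : ℕ → Set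
Perm n = Fin n → Fin n

_·_ : ∀ {n} → Perm n → Perm n → Perm n
(x · y) k = x (y k)
infixl 7 _·_

idP : ∀ {n} → Perm n
idP k = k

swap : ∀ {n} → Fin n → Fin n → Perm n
swap a b k with k ≟ a
... | yes _ = b
... | no _ with k ≟ b
...   | yes _ = a
...   | no _ = k

toFinOr : ∀ {n} → ℕ → Fin n → Fin n
toFinOr {n} v d with v <? n
... | yes p = fromℕ< p
... | no _ = d

swapℕ : ∀ {n} → ℕ → ℕ → Perm n
swapℕ a b k with toℕ k ℕ.≟ a
... | yes _ = toFinOr b k
... | no _ with toℕ k ℕ.≟ b
...   | yes _ = toFinOr a k
...   | no _ = k

-- simple reflection s_i = (i, i+1) (1-based), i.e. swaps 0-based i-1 and i
s : ∀ {n} → ℕ → Perm n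
s i = swapℕ (i ∸ 1) i

allPairs : ∀ n → List (Fin n × Fin n)
allPairs n = concatMap (λ a → map (λ b → (a , b)) (allFin n)) (allFin n)

len : ∀ {n} → Perm n → ℕ
len {n} w = length (filter (λ p → (proj₁ p <F? proj₂ p) ×-dec (w (proj₂ p) <F? w (proj₁ p))) (allPairs n))

IsFPF : ∀ {m} → Perm m → Set
IsFPF z = (∀ k → z (z k) ≡ k) × (∀ k → z k ≢ k)

IsTransposition : ∀ {n} → Perm n → Set
IsTransposition {n} t = Σ (Fin n) λ a → Σ (Fin n) λ b → a ≢ b × (∀ k → t k ≡ swap a b k)

BruhatStep : ∀ {n} → Perm n → Perm n → Set
BruhatStep {n} z y = Σ (Perm n) λ t → IsTransposition t × (∀ k → y k ≡ (t · z · t) k) × (len z ℕ.≤ len y)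

_≤B_ : ∀ {n} → Perm n → Perm n → Set
_≤B_ = Star BruhatStep

embed : ∀ {n} → Perm (n ∸ 2) → Perm n
embed {n} z k with toℕ k <? (n ∸ 2)
... | yes p = inject≤ (z (fromℕ< p)) (m∸n≤m n 2)
... | no _ = k

w₀ : ∀ {n} → Perm n
w₀ = opposite

ρ : ∀ {n} → Perm (n ∸ 2) → Perm n
ρ {n} z = w₀ · embed z · s (n ∸ 1) · w₀

InY₁ : ∀ {n} → Perm n → Set
InY₁ {n} x = Σ (Perm (n ∸ 2)) λ z → IsFPF z × (∀ k → x k ≡ ρ z k)

σ : ∀ {n} → ℕ → Perm n
σ zero = idP
σ (suc j) = s (suc j) · σ j

σ⁻¹ : ∀ {n} → ℕ → Perm n
σ⁻¹ zero = idP
σ⁻¹ (suc j) = σ⁻¹ j · s (suc j)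

ν : ∀ {n} → ℕ → Perm n → Perm n
ν j x = σ j · x · σ⁻¹ j

{-# OPTIONS --safe #-}
module Submission where

-- We have ν_{j+1}(x) = s_{j+1} ν_j(x) s_{j+1} (here even definitionally), so it suffices
-- that this conjugation does not decrease the length.  Every x = ρ_n(z) is an involution with
-- x(1) = 2; hence ν_j(x) is an involution with ν_j(x)(j+1) = 1, since σ_j⁻¹ sends j+1 to 1 and
-- σ_j sends 2 to 1.  For an involution w with w(c) = 1, conjugation by s_c maps every inversion
-- (a, b) of w to the inversion (s_c a, s_c b) of s_c w s_c: s_c reverses the order of the pair
-- (c, c+1) only, and neither (a, b) nor (w b, w a) can be that pair because w(c) = 1 is minimal.

open import Algebra.Definitions using (Involutive)
open import Data.Empty using (⊥-elim)
open import Data.Fin as Fin using (Fin; zero; suc; toℕ; fromℕ<; inject≤)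
open import Data.Fin.Permutation using (permutation)
open import Data.Fin.Properties
  using (toℕ-injective; toℕ-fromℕ<; toℕ<n; toℕ-inject≤; opposite-prop; opposite-involutive; _≟_; _<?_)
open import Data.List using (List; []; _∷_; map; concat; filter; length; tabulate; allFin)
open import Data.List.Properties using (map-tabulate; map-concatMap; map-cong; map-∘)
open import Data.Nat as ℕ using (ℕ; zero; suc; _+_; _*_; _∸_; _≤_; _<_; z≤n; s≤s)
open import Data.Nat.ListAction as List using ()
open import Data.Nat.ListAction.Properties using (sum-++)
open import Data.Nat.Properties
  using (+-mono-≤; ≤-refl; ≤-reflexive; ≤-trans; <-trans; n<1+n; n≮0; 1+n≢n; <⇒≱; ≮⇒≥;
         m≤n⇒m<n∨m≡n; m∸n≤m; m+n∸n≡m; +-0-commutativeMonoid; module ≤-Reasoning)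
open import Data.Product using (∃; _×_; _,_; proj₁; proj₂)
open import Data.Sum using (inj₁; inj₂)
open import Function using (_∘_)
open import Relation.Binary.Construct.Closure.ReflexiveTransitive using (ε; _◅_; _◅◅_)
open import Relation.Binary.PropositionalEquality
  using (_≡_; _≢_; refl; sym; trans; cong; subst; subst₂; module ≡-Reasoning)
open import Relation.Nullary using (Dec; yes; no; ¬_)
open import Relation.Nullary.Decidable using (_×-dec_)

open import Algebra.Properties.CommutativeMonoid.Sum +-0-commutativeMonoid
  using (sum-syntax; sum-cong-≗; sum-permute)

open import Defs

-- Counting inversions

indicator : ∀ {p} {P : Set p} → Dec P → ℕ
indicator (yes _) = 1
indicator (no _)  = 0

indicator-mono : ∀ {p q} {P : Set p} {Q : Set q} (P? : Dec P) (Q? : Dec Q) →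
                 (P → Q) → indicator P? ≤ indicator Q?
indicator-mono (no _)  _        _   = z≤n
indicator-mono (yes _) (yes _)  _   = ≤-refl
indicator-mono (yes p) (no ¬q)  p⇒q = ⊥-elim (¬q (p⇒q p))

length-filter≡sum-indicator : ∀ {a p} {A : Set a} {P : A → Set p} (P? : ∀ x → Dec (P x)) xs →
                              length (filter P? xs) ≡ List.sum (map (indicator ∘ P?) xs)
length-filter≡sum-indicator P? []       = refl
length-filter≡sum-indicator P? (x ∷ xs) with P? x
... | yes _ = cong suc (length-filter≡sum-indicator P? xs)
... | no _  = length-filter≡sum-indicator P? xs

sum-concat : (xss : List (List ℕ)) → List.sum (concat xss) ≡ List.sum (map List.sum xss)
sum-concat []         = refl
sum-concat (xs ∷ xss) = trans (sum-++ xs (concat xss)) (cong (List.sum xs +_) (sum-concat xss))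

sum-tabulate : ∀ {n} (f : Fin n → ℕ) → List.sum (tabulate f) ≡ ∑[ i < n ] f i
sum-tabulate {zero}  f = refl
sum-tabulate {suc n} f = cong (f zero +_) (sum-tabulate (f ∘ suc))

sum-map-allFin : ∀ {n} (f : Fin n → ℕ) → List.sum (map f (allFin n)) ≡ ∑[ i < n ] f i
sum-map-allFin f = trans (cong List.sum (map-tabulate (λ i → i) f)) (sum-tabulate f)

sum-map-allPairs : ∀ {n} (f : Fin n × Fin n → ℕ) →
                   List.sum (map f (allPairs n)) ≡ ∑[ a < n ] ∑[ b < n ] f (a , b)
sum-map-allPairs {n} f = begin
  List.sum (map f (allPairs n))
    ≡⟨ cong List.sum (map-concatMap f row (allFin n)) ⟩
  List.sum (concat (map (map f ∘ row) (allFin n)))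
    ≡⟨ sum-concat (map (map f ∘ row) (allFin n)) ⟩
  List.sum (map List.sum (map (map f ∘ row) (allFin n)))
    ≡⟨ cong List.sum (sym (map-∘ (allFin n))) ⟩
  List.sum (map (List.sum ∘ map f ∘ row) (allFin n))
    ≡⟨ cong List.sum (map-cong row-sum (allFin n)) ⟩
  List.sum (map (λ a → ∑[ b < n ] f (a , b)) (allFin n))
    ≡⟨ sum-map-allFin (λ a → ∑[ b < n ] f (a , b)) ⟩
  ∑[ a < n ] ∑[ b < n ] f (a , b) ∎
  where
  open ≡-Reasoning
  row : Fin n → List (Fin n × Fin n)
  row a = map (a ,_) (allFin n)
  row-sum : ∀ a → List.sum (map f (row a)) ≡ ∑[ b < n ] f (a , b)
  row-sum a = trans (cong List.sum (sym (map-∘ (allFin n)))) (sum-map-allFin (λ b → f (a , b)))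

∑-mono-≤ : ∀ {n} {f g : Fin n → ℕ} → (∀ i → f i ≤ g i) → ∑[ i < n ] f i ≤ ∑[ i < n ] g i
∑-mono-≤ {zero}  _   = z≤n
∑-mono-≤ {suc n} f≤g = +-mono-≤ (f≤g zero) (∑-mono-≤ (f≤g ∘ suc))

∑-reindex-involution : ∀ {n} {t : Perm n} → Involutive _≡_ t → (f : Fin n → ℕ) →
                       ∑[ i < n ] f i ≡ ∑[ i < n ] f (t i)
∑-reindex-involution {t = t} t-involutive f = sum-permute f (permutation t t t-involutive t-involutive)

Inversion : ∀ {n} → Perm n → Fin n → Fin n → Set
Inversion w a b = a Fin.< b × w b Fin.< w a

inversion? : ∀ {n} (w : Perm n) a b → Dec (Inversion w a b)
inversion? w a b = (a <? b) ×-dec (w b <? w a)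

len≡∑inversions : ∀ {n} (w : Perm n) → len w ≡ ∑[ a < n ] ∑[ b < n ] indicator (inversion? w a b)
len≡∑inversions {n} w =
  trans (length-filter≡sum-indicator (λ p → inversion? w (proj₁ p) (proj₂ p)) (allPairs n))
        (sum-map-allPairs {n} _)

len-≤-conjugate : ∀ {n} (w t : Perm n) → Involutive _≡_ t →
                  (∀ {a b} → Inversion w a b → Inversion (t · w · t) (t a) (t b)) →
                  len w ≤ len (t · w · t)
len-≤-conjugate {n} w t t-involutive preserves = begin
  len w
    ≡⟨ len≡∑inversions w ⟩
  ∑[ a < n ] ∑[ b < n ] indicator (inversion? w a b)
    ≤⟨ ∑-mono-≤ {n} (λ a → ∑-mono-≤ {n} (λ b → indicator-mono _ _ preserves)) ⟩
  ∑[ a < n ] ∑[ b < n ] ι (t a) (t b)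
    ≡⟨ sum-cong-≗ (λ a → ∑-reindex-involution t-involutive (ι (t a))) ⟨
  ∑[ a < n ] ∑[ b < n ] ι (t a) b
    ≡⟨ ∑-reindex-involution t-involutive (λ a → ∑[ b < n ] ι a b) ⟨
  ∑[ a < n ] ∑[ b < n ] ι a b
    ≡⟨ len≡∑inversions (t · w · t) ⟨
  len (t · w · t) ∎
  where
  open ≤-Reasoning
  ι : Fin n → Fin n → ℕ
  ι a b = indicator (inversion? (t · w · t) a b)

-- Adjacent transpositions

adjacentSwap : ℕ → ℕ → ℕ
adjacentSwap zero    zero          = 1
adjacentSwap zero    (suc zero)    = 0
adjacentSwap zero    (suc (suc k)) = suc (suc k)
adjacentSwap (suc c) zero          = zero
adjacentSwap (suc c) (suc k)       = suc (adjacentSwap c k)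

adjacentSwap-involutive : ∀ c k → adjacentSwap c (adjacentSwap c k) ≡ k
adjacentSwap-involutive zero    zero          = refl
adjacentSwap-involutive zero    (suc zero)    = refl
adjacentSwap-involutive zero    (suc (suc k)) = refl
adjacentSwap-involutive (suc c) zero          = refl
adjacentSwap-involutive (suc c) (suc k)       = cong suc (adjacentSwap-involutive c k)

adjacentSwap-self : ∀ c → adjacentSwap c c ≡ suc c
adjacentSwap-self zero    = refl
adjacentSwap-self (suc c) = cong suc (adjacentSwap-self c)

adjacentSwap-suc-self : ∀ c → adjacentSwap c (suc c) ≡ c
adjacentSwap-suc-self zero    = refl
adjacentSwap-suc-self (suc c) = cong suc (adjacentSwap-suc-self c)

adjacentSwap-fixes : ∀ {c k} → k ≢ c → k ≢ suc c → adjacentSwap c k ≡ k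
adjacentSwap-fixes {zero}  {zero}        k≢c _    = ⊥-elim (k≢c refl)
adjacentSwap-fixes {zero}  {suc zero}    _   k≢1+c = ⊥-elim (k≢1+c refl)
adjacentSwap-fixes {zero}  {suc (suc k)} _   _    = refl
adjacentSwap-fixes {suc c} {zero}        _   _    = refl
adjacentSwap-fixes {suc c} {suc k}       k≢c k≢1+c =
  cong suc (adjacentSwap-fixes (k≢c ∘ cong suc) (k≢1+c ∘ cong suc))

adjacentSwap-< : ∀ {c k} → k < c → adjacentSwap c k ≡ k
adjacentSwap-< {suc c} {zero}  _         = refl
adjacentSwap-< {suc c} {suc k} (s≤s k<c) = cong suc (adjacentSwap-< k<c)

adjacentSwap-≥ : ∀ {c k} → c ≤ k → c ≤ adjacentSwap c k
adjacentSwap-≥ {zero}          _         = z≤n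
adjacentSwap-≥ {suc c} {suc k} (s≤s c≤k) = s≤s (adjacentSwap-≥ c≤k)

adjacentSwap-<-mono : ∀ {c u v} → u < v → ¬ (u ≡ c × v ≡ suc c) → adjacentSwap c u < adjacentSwap c v
adjacentSwap-<-mono {zero}  {zero}        {suc zero}    _         excluded = ⊥-elim (excluded (refl , refl))
adjacentSwap-<-mono {zero}  {zero}        {suc (suc v)} _         _        = s≤s (s≤s z≤n)
adjacentSwap-<-mono {zero}  {suc zero}    {suc zero}    (s≤s ())  _
adjacentSwap-<-mono {zero}  {suc zero}    {suc (suc v)} _         _        = s≤s z≤n
adjacentSwap-<-mono {zero}  {suc (suc u)} {suc zero}    (s≤s ())  _
adjacentSwap-<-mono {zero}  {suc (suc u)} {suc (suc v)} u<v       _        = u<v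
adjacentSwap-<-mono {suc c} {zero}        {suc v}       _         _        = s≤s z≤n
adjacentSwap-<-mono {suc c} {suc u}       {suc v}       (s≤s u<v) excluded =
  s≤s (adjacentSwap-<-mono u<v (λ (u≡c , v≡1+c) → excluded (cong suc u≡c , cong suc v≡1+c)))

IsAdjacentSwap : ∀ {n} → ℕ → Perm n → Set
IsAdjacentSwap c t = ∀ k → toℕ (t k) ≡ adjacentSwap c (toℕ k)

module _ {n c} {t : Perm n} (t-swaps : IsAdjacentSwap c t) where

  isAdjacentSwap⇒involutive : Involutive _≡_ t
  isAdjacentSwap⇒involutive k = toℕ-injective (begin
    toℕ (t (t k))                           ≡⟨ t-swaps (t k) ⟩
    adjacentSwap c (toℕ (t k))              ≡⟨ cong (adjacentSwap c) (t-swaps k) ⟩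
    adjacentSwap c (adjacentSwap c (toℕ k)) ≡⟨ adjacentSwap-involutive c (toℕ k) ⟩
    toℕ k                                   ∎)
    where open ≡-Reasoning

  isAdjacentSwap-unique : ∀ {u : Perm n} → IsAdjacentSwap c u → ∀ k → t k ≡ u k
  isAdjacentSwap-unique u-swaps k = toℕ-injective (trans (t-swaps k) (sym (u-swaps k)))

  isAdjacentSwap-<-mono : ∀ {a b} → a Fin.< b → ¬ (toℕ a ≡ c × toℕ b ≡ suc c) → t a Fin.< t b
  isAdjacentSwap-<-mono {a} {b} a<b excluded =
    subst₂ _<_ (sym (t-swaps a)) (sym (t-swaps b)) (adjacentSwap-<-mono a<b excluded)

  isAdjacentSwap-fixes-< : ∀ {k} → toℕ k < c → t k ≡ k
  isAdjacentSwap-fixes-< {k} k<c = toℕ-injective (trans (t-swaps k) (adjacentSwap-< k<c))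

  isAdjacentSwap-≥ : ∀ {k} → c ≤ toℕ k → c ≤ toℕ (t k)
  isAdjacentSwap-≥ {k} c≤k = subst (c ≤_) (sym (t-swaps k)) (adjacentSwap-≥ c≤k)

toFinOr-< : ∀ {n v} (d : Fin n) → v < n → toℕ (toFinOr v d) ≡ v
toFinOr-< {n} {v} d v<n with v ℕ.<? n
... | yes v<n′ = toℕ-fromℕ< v<n′
... | no v≮n  = ⊥-elim (v≮n v<n)

s-isAdjacentSwap : ∀ {n c} → suc c < n → IsAdjacentSwap c (s {n} (suc c))
s-isAdjacentSwap {n} {c} 1+c<n k with toℕ k ℕ.≟ c
... | yes k≡c = trans (toFinOr-< k 1+c<n) (sym (trans (cong (adjacentSwap c) k≡c) (adjacentSwap-self c)))
... | no k≢c with toℕ k ℕ.≟ suc c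
...   | yes k≡1+c = trans (toFinOr-< k (<-trans (n<1+n c) 1+c<n))
                          (sym (trans (cong (adjacentSwap c) k≡1+c) (adjacentSwap-suc-self c)))
...   | no k≢1+c  = sym (adjacentSwap-fixes k≢c k≢1+c)

swap-isAdjacentSwap : ∀ {n c} {a b : Fin n} → toℕ a ≡ c → toℕ b ≡ suc c → IsAdjacentSwap c (swap a b)
swap-isAdjacentSwap {c = c} {a} {b} a≡c b≡1+c k with k ≟ a
... | yes refl = trans b≡1+c (sym (trans (cong (adjacentSwap c) a≡c) (adjacentSwap-self c)))
... | no k≢a with k ≟ b
...   | yes refl = trans a≡c (sym (trans (cong (adjacentSwap c) b≡1+c) (adjacentSwap-suc-self c)))
...   | no k≢b   = sym (adjacentSwap-fixes (λ k≡c → k≢a (toℕ-injective (trans k≡c (sym a≡c))))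
                                         (λ k≡1+c → k≢b (toℕ-injective (trans k≡1+c (sym b≡1+c)))))

s-isTransposition : ∀ {n c} → suc c < n → IsTransposition (s {n} (suc c))
s-isTransposition {n} {c} 1+c<n =
  a , b , a≢b , isAdjacentSwap-unique (s-isAdjacentSwap 1+c<n) (swap-isAdjacentSwap a≡c b≡1+c)
  where
  a b : Fin n
  a = fromℕ< (<-trans (n<1+n c) 1+c<n)
  b = fromℕ< 1+c<n
  a≡c : toℕ a ≡ c
  a≡c = toℕ-fromℕ< _
  b≡1+c : toℕ b ≡ suc c
  b≡1+c = toℕ-fromℕ< _
  a≢b : a ≢ b
  a≢b a≡b = 1+n≢n (trans (sym b≡1+c) (trans (cong toℕ (sym a≡b)) a≡c))

len-≤-conjugate-adjacentSwap : ∀ {n c} {w t : Perm n} → Involutive _≡_ w →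
                               (∀ {p} → toℕ p ≡ c → toℕ (w p) ≡ 0) →
                               IsAdjacentSwap c t → len w ≤ len (t · w · t)
len-≤-conjugate-adjacentSwap {c = c} {w} {t} w-involutive w-to-0 t-swaps =
  len-≤-conjugate w t t-involutive preserves
  where
  t-involutive : Involutive _≡_ t
  t-involutive = isAdjacentSwap⇒involutive t-swaps
  nothing-below-0 : ∀ {p q : Fin _} → toℕ p ≡ 0 → ¬ (q Fin.< p)
  nothing-below-0 {q = q} p≡0 = n≮0 ∘ subst (toℕ q <_) p≡0
  preserves : ∀ {a b} → Inversion w a b → Inversion (t · w · t) (t a) (t b)
  preserves {a} {b} (a<b , wb<wa) =
    isAdjacentSwap-<-mono t-swaps a<b (λ (a≡c , _) → nothing-below-0 (w-to-0 a≡c) wb<wa) ,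
    subst₂ (λ a′ b′ → t (w b′) Fin.< t (w a′)) (sym (t-involutive a)) (sym (t-involutive b))
      (isAdjacentSwap-<-mono t-swaps wb<wa (λ (wb≡c , _) → nothing-below-0 (b≡0 wb≡c) a<b))
    where
    b≡0 : toℕ (w b) ≡ c → toℕ b ≡ 0
    b≡0 wb≡c = trans (cong toℕ (sym (w-involutive b))) (w-to-0 wb≡c)

-- The conjugates ν_j(x)

σ⁻¹-σ : ∀ {n} j → j < n → ∀ k → σ⁻¹ {n} j (σ j k) ≡ k
σ⁻¹-σ zero    _     k = refl
σ⁻¹-σ (suc j) 1+j<n k =
  trans (cong (σ⁻¹ j) (isAdjacentSwap⇒involutive (s-isAdjacentSwap 1+j<n) (σ j k)))
        (σ⁻¹-σ j (<-trans (n<1+n j) 1+j<n) k)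

σ-σ⁻¹ : ∀ {n} j → j < n → ∀ k → σ {n} j (σ⁻¹ j k) ≡ k
σ-σ⁻¹ zero    _     k = refl
σ-σ⁻¹ (suc j) 1+j<n k =
  trans (cong (s (suc j)) (σ-σ⁻¹ j (<-trans (n<1+n j) 1+j<n) (s (suc j) k)))
        (isAdjacentSwap⇒involutive (s-isAdjacentSwap 1+j<n) k)

ν-involutive : ∀ {n} {x : Perm n} j → j < n → Involutive _≡_ x → Involutive _≡_ (ν j x)
ν-involutive {x = x} j j<n x-involutive k = begin
  σ j (x (σ⁻¹ j (σ j (x (σ⁻¹ j k))))) ≡⟨ cong (σ j ∘ x) (σ⁻¹-σ j j<n (x (σ⁻¹ j k))) ⟩
  σ j (x (x (σ⁻¹ j k)))               ≡⟨ cong (σ j) (x-involutive (σ⁻¹ j k)) ⟩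
  σ j (σ⁻¹ j k)                       ≡⟨ σ-σ⁻¹ j j<n k ⟩
  k                                   ∎
  where open ≡-Reasoning

σ⁻¹-j↦0 : ∀ {n} j {k : Fin n} → toℕ k ≡ j → toℕ (σ⁻¹ j k) ≡ 0
σ⁻¹-j↦0 zero        k≡0   = k≡0
σ⁻¹-j↦0 (suc j) {k} k≡1+j = σ⁻¹-j↦0 j (begin
  toℕ (s (suc j) k)            ≡⟨ s-isAdjacentSwap (subst (_< _) k≡1+j (toℕ<n k)) k ⟩
  adjacentSwap j (toℕ k)       ≡⟨ cong (adjacentSwap j) k≡1+j ⟩
  adjacentSwap j (suc j)       ≡⟨ adjacentSwap-suc-self j ⟩
  j                            ∎)
  where open ≡-Reasoning

σ-1↦0 : ∀ {n} j {k : Fin n} → suc j < n → toℕ k ≡ 1 → toℕ (σ (suc j) k) ≡ 0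
σ-1↦0 zero    {k} 1<n   k≡1 = trans (s-isAdjacentSwap 1<n k) (cong (adjacentSwap 0) k≡1)
σ-1↦0 (suc j) {k} 2+j<n k≡1 =
  trans (s-isAdjacentSwap 2+j<n (σ (suc j) k))
        (cong (adjacentSwap (suc j)) (σ-1↦0 j (<-trans (n<1+n _) 2+j<n) k≡1))

module _ {n} (x : Perm (suc n)) (x-involutive : Involutive _≡_ x) (x0≡1 : toℕ (x zero) ≡ 1) where

  ν-j↦0 : ∀ {j} → 1 ≤ j → j < suc n → ∀ {p} → toℕ p ≡ j → toℕ (ν j x p) ≡ 0
  ν-j↦0 {suc j} _ 1+j<n {p} p≡1+j =
    σ-1↦0 j 1+j<n (trans (cong (toℕ ∘ x) σ⁻¹p≡0) x0≡1)
    where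
    σ⁻¹p≡0 : σ⁻¹ (suc j) p ≡ zero
    σ⁻¹p≡0 = toℕ-injective (σ⁻¹-j↦0 (suc j) p≡1+j)

  ν-step : ∀ {j} → 1 ≤ j → suc j < suc n → BruhatStep (ν j x) (ν (suc j) x)
  ν-step {j} 1≤j 1+j<n =
    s (suc j) , s-isTransposition 1+j<n , (λ _ → refl) ,
    len-≤-conjugate-adjacentSwap (ν-involutive {x = x} j j<n x-involutive) (ν-j↦0 1≤j j<n)
                                 (s-isAdjacentSwap 1+j<n)
    where
    j<n : j < suc n
    j<n = <-trans (n<1+n j) 1+j<n

  ν-mono : ∀ {i j} → 1 ≤ i → i ≤ j → j < suc n → ν i x ≤B ν j x
  ν-mono 1≤i i≤j j<n with m≤n⇒m<n∨m≡n i≤j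
  ... | inj₂ refl = ε
  ... | inj₁ (s≤s {n = j′} i≤j′) =
    ν-mono {j = j′} 1≤i i≤j′ (<-trans (n<1+n j′) j<n) ◅◅ ν-step (≤-trans 1≤i i≤j′) j<n ◅ ε

-- The set Y₁

module _ {m : ℕ} where

  private
    N : ℕ
    N = suc (suc m)
    m≤N : m ≤ N
    m≤N = m∸n≤m N 2
    S : Perm N
    S = s (suc m)
    S-swaps : IsAdjacentSwap m S
    S-swaps = s-isAdjacentSwap ≤-refl

  data EmbedView : Fin N → Set where
    below : ∀ i → EmbedView (inject≤ i m≤N)
    above : ∀ {k} → m ≤ toℕ k → EmbedView k

  embedView : ∀ k → EmbedView k
  embedView k with toℕ k ℕ.<? m
  ... | yes k<m = subst EmbedView (toℕ-injective (trans (toℕ-inject≤ _ m≤N) (toℕ-fromℕ< k<m)))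
                                  (below (fromℕ< k<m))
  ... | no k≮m  = above (≮⇒≥ k≮m)

  S-fixes-below : ∀ i → S (inject≤ i m≤N) ≡ inject≤ i m≤N
  S-fixes-below i = isAdjacentSwap-fixes-< S-swaps (subst (_< m) (sym (toℕ-inject≤ i m≤N)) (toℕ<n i))

  module _ (z : Perm m) where

    embed-inject≤ : ∀ i → embed {N} z (inject≤ i m≤N) ≡ inject≤ (z i) m≤N
    embed-inject≤ i with toℕ (inject≤ i m≤N) ℕ.<? m
    ... | yes i<m =
      cong (λ j → inject≤ (z j) m≤N) (toℕ-injective (trans (toℕ-fromℕ< i<m) (toℕ-inject≤ i m≤N)))
    ... | no i≮m  = ⊥-elim (i≮m (subst (_< m) (sym (toℕ-inject≤ i m≤N)) (toℕ<n i)))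

    embed-≥ : ∀ {k : Fin N} → m ≤ toℕ k → embed z k ≡ k
    embed-≥ {k} m≤k with toℕ k ℕ.<? m
    ... | yes k<m = ⊥-elim (<⇒≱ k<m m≤k)
    ... | no _    = refl

    embed-involutive : Involutive _≡_ z → Involutive _≡_ (embed {N} z)
    embed-involutive z-involutive k with embedView k
    ... | below i = begin
      embed z (embed z (inject≤ i m≤N)) ≡⟨ cong (embed z) (embed-inject≤ i) ⟩
      embed z (inject≤ (z i) m≤N)       ≡⟨ embed-inject≤ (z i) ⟩
      inject≤ (z (z i)) m≤N             ≡⟨ cong (λ j → inject≤ j m≤N) (z-involutive i) ⟩
      inject≤ i m≤N                     ∎
      where open ≡-Reasoning
    ... | above m≤k = trans (cong (embed z) (embed-≥ m≤k)) (embed-≥ m≤k)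

    embed-S-comm : ∀ k → embed {N} z (S k) ≡ S (embed z k)
    embed-S-comm k with embedView k
    ... | below i = begin
      embed z (S (inject≤ i m≤N)) ≡⟨ cong (embed z) (S-fixes-below i) ⟩
      embed z (inject≤ i m≤N)     ≡⟨ embed-inject≤ i ⟩
      inject≤ (z i) m≤N           ≡⟨ S-fixes-below (z i) ⟨
      S (inject≤ (z i) m≤N)       ≡⟨ cong S (embed-inject≤ i) ⟨
      S (embed z (inject≤ i m≤N)) ∎
      where open ≡-Reasoning
    ... | above m≤k = trans (embed-≥ (isAdjacentSwap-≥ S-swaps m≤k)) (cong S (sym (embed-≥ m≤k)))

    ρ-involutive : Involutive _≡_ z → Involutive _≡_ (ρ {N} z)
    ρ-involutive z-involutive k = begin
      w₀ (E (S (w₀ (w₀ (E (S (w₀ k))))))) ≡⟨ cong (w₀ ∘ E ∘ S) (opposite-involutive (E (S (w₀ k)))) ⟩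
      w₀ (E (S (E (S (w₀ k)))))           ≡⟨ cong (w₀ ∘ E) (embed-S-comm (S (w₀ k))) ⟨
      w₀ (E (E (S (S (w₀ k)))))           ≡⟨ cong w₀ (embed-involutive z-involutive (S (S (w₀ k)))) ⟩
      w₀ (S (S (w₀ k)))                   ≡⟨ cong w₀ (isAdjacentSwap⇒involutive S-swaps (w₀ k)) ⟩
      w₀ (w₀ k)                           ≡⟨ opposite-involutive k ⟩
      k                                   ∎
      where
      open ≡-Reasoning
      E : Perm N
      E = embed z

    ρ-zero : toℕ (ρ {N} z zero) ≡ 1
    ρ-zero = begin
      toℕ (w₀ (embed z (S (w₀ zero))))
        ≡⟨ opposite-prop (embed z (S (w₀ zero))) ⟩
      N ∸ suc (toℕ (embed z (S (w₀ zero))))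
        ≡⟨ cong (λ i → N ∸ suc (toℕ i)) (embed-≥ (≤-reflexive (sym S-w₀-zero))) ⟩
      N ∸ suc (toℕ (S (w₀ zero)))
        ≡⟨ cong (λ i → N ∸ suc i) S-w₀-zero ⟩
      N ∸ suc m
        ≡⟨ m+n∸n≡m 1 m ⟩
      1 ∎
      where
      open ≡-Reasoning
      S-w₀-zero : toℕ (S (w₀ zero)) ≡ m
      S-w₀-zero = begin
        toℕ (S (w₀ zero))                  ≡⟨ S-swaps (w₀ zero) ⟩
        adjacentSwap m (toℕ (w₀ {N} zero)) ≡⟨ cong (adjacentSwap m) (opposite-prop {N} zero) ⟩
        adjacentSwap m (suc m)             ≡⟨ adjacentSwap-suc-self m ⟩
        m                                  ∎

mainTheorem20 : (n : ℕ) → 4 ≤ n → ∃ (λ k → n ≡ 2 * k) →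
    (x : Perm n) → InY₁ x →
    (i j : ℕ) → 1 ≤ i → i ≤ j → j ≤ n ∸ 1 →
    ν i x ≤B ν j x
mainTheorem20 (suc (suc m)) (s≤s (s≤s _)) _ x (z , (z-involutive , _) , x≗ρz) i j 1≤i i≤j j≤n-1 =
  ν-mono x x-involutive x-zero 1≤i i≤j (s≤s j≤n-1)
  where
  x-involutive : Involutive _≡_ x
  x-involutive k = trans (x≗ρz (x k)) (trans (cong (ρ z) (x≗ρz k)) (ρ-involutive z z-involutive k))
  x-zero : toℕ (x zero) ≡ 1
  x-zero = trans (cong toℕ (x≗ρz zero)) (ρ-zero z)
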